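{- Let $k\ge 1$, let $n_1,\dots,n_k \ge 2$ and $n_{k+1}\ge 1$ be integers such that $N=\sum_{i=1}^{k+1} n_i$ is composite, and let $$U = U_{n_1}\oplus U_{n_2}\oplus\dots\oplus U_{n_k}\oplus I_{n_{k+1}},$$ where $U_m = \frac{2}{m}J_m - I_m$. Then $U$ is a global unitary operator: for every factorization $N = pq$ with integers $p,q\ge2$, there do not exist unitary matrices $u_1$ of order $p$ and $u_2$ of order $q$ with $U = u_1\otimes u_2$.
   Context: $J_m$ is the $m\times m$ all-ones matrix, $I_m$ the identity, $\oplus$ the block-diagonal direct sum, $\otimes$ the Kronecker/tensor product. A unitary operator on $\mathbb{C}^p\otimes\mathbb{C}^q$ is local if it equals $u_1\otimes u_2$ for unitaries $u_1,u_2$ on the factors, and global otherwise. -}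

module Defs where

open import Level using (Level; _⊔_)
open import Data.Nat using (ℕ; zero; suc)
import Data.Nat as ℕ
open import Data.Fin using (Fin; zero; suc; splitAt; remQuot; cast)
open import Data.Sum using (inj₁; inj₂)
open import Data.Product using (_,_)
open import Data.Vec using (Vec; []; _∷_)
open import Relation.Nullary using (¬_)
open import Algebra.Bundles using (CommutativeRing)

natElem : ∀ {c ℓ} (R : CommutativeRing c ℓ) → ℕ → CommutativeRing.Carrier R
natElem R zero    = CommutativeRing.0# R
natElem R (suc n) = CommutativeRing._+_ R (CommutativeRing.1# R) (natElem R n)

-- A field of characteristic 0 equipped with an involutive ring automorphism
-- ("complex conjugation").  The complex numbers (with z ↦ z̄) are the
-- intended model; the stdlib has no ℂ.
record StarField (c ℓ : Level) : Set (Level.suc (c ⊔ ℓ)) where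
  field
    cring : CommutativeRing c ℓ
  open CommutativeRing cring public
  field
    1≉0     : ¬ (1# ≈ 0#)
    _⁻¹     : (x : Carrier) → ¬ (x ≈ 0#) → Carrier
    ⁻¹-inv  : (x : Carrier) (nz : ¬ (x ≈ 0#)) → x * (_⁻¹ x nz) ≈ 1#
    char0   : (n : ℕ) → ¬ (natElem cring (ℕ.suc n) ≈ 0#)
    conj      : Carrier → Carrier
    conj-cong : ∀ {x y} → x ≈ y → conj x ≈ conj y
    conj-+    : ∀ x y → conj (x + y) ≈ conj x + conj y
    conj-*    : ∀ x y → conj (x * y) ≈ conj x * conj y
    conj-1    : conj 1# ≈ 1#
    conj-invol : ∀ x → conj (conj x) ≈ x
  _×1 : ℕ → Carrier
  _×1 = natElem cring

module Matrices {c ℓ : Level} (F : StarField c ℓ) where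
  open StarField F public
    using (Carrier; _≈_; _+_; _*_; _-_; 0#; 1#; _⁻¹; _×1; char0; conj)

  Mat : ℕ → ℕ → Set c
  Mat m n = Fin m → Fin n → Carrier

  sumFin : (n : ℕ) → (Fin n → Carrier) → Carrier
  sumFin zero    f = 0#
  sumFin (suc n) f = f zero + sumFin n (λ i → f (suc i))

  _·_ : ∀ {m n o} → Mat m n → Mat n o → Mat m o
  (A · B) i k = sumFin _ (λ j → A i j * B j k)

  _† : ∀ {m n} → Mat m n → Mat n m
  (A †) i j = conj (A j i)

  δ : ∀ {n} → Fin n → Fin n → Carrier
  δ zero    zero    = 1#
  δ zero    (suc j) = 0#
  δ (suc i) zero    = 0#
  δ (suc i) (suc j) = δ i j

  I : (n : ℕ) → Mat n n
  I n = δ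

  J : (n : ℕ) → Mat n n
  J n i j = 1#

  _≋_ : ∀ {m n} → Mat m n → Mat m n → Set ℓ
  A ≋ B = ∀ i j → A i j ≈ B i j

  Unitary : ∀ {n} → Mat n n → Set ℓ
  Unitary {n} u = ((u · (u †)) ≋ I n) Data.Product.× (((u †) · u) ≋ I n)

  _⊕_ : ∀ {m n} → Mat m m → Mat n n → Mat (m ℕ.+ n) (m ℕ.+ n)
  _⊕_ {m} A B x y with splitAt m x | splitAt m y
  ... | inj₁ i | inj₁ j = A i j
  ... | inj₂ i | inj₂ j = B i j
  ... | inj₁ _ | inj₂ _ = 0#
  ... | inj₂ _ | inj₁ _ = 0#

  -- Kronecker product, standard ordering: index (i,j) ↦ i*q + j
  _⊗_ : ∀ {p q} → Mat p p → Mat q q → Mat (p Data.Nat.* q) (p Data.Nat.* q)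
  _⊗_ {p} {q} A B x y with remQuot {p} q x | remQuot {p} q y
  ... | i , j | i' , j' = A i i' * B j j'

  Ublock : (m : ℕ) → Mat m m
  Ublock zero    ()
  Ublock (suc m) i j = ((2 ×1) * _⁻¹ ((suc m) ×1) (char0 m)) * J (suc m) i j - I (suc m) i j

  dim : ∀ {k} → Vec ℕ k → ℕ → ℕ
  dim []       nl = nl
  dim (n ∷ ns) nl = n ℕ.+ dim ns nl

  Umat : ∀ {k} (ns : Vec ℕ k) (nl : ℕ) → Mat (dim ns nl) (dim ns nl)
  Umat []       nl = I nl
  Umat (n ∷ ns) nl = Ublock n ⊕ Umat ns nl

-- Only the pattern of entries of U matters, not unitarity.  Index the rows of u₁ ⊗ u₂ by q i + j;
-- its entries satisfy the exchange identity T(i,j;i′,j′) T(k,l;k′,l′) = T(i,l;i′,l′) T(k,j;k′,j′).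
-- Use it on the rows (0,0), (0,q-1), (p-1,0), (p-1,q-1).  Since U₀₁ = 2/n₁ ≠ 0 and the last
-- diagonal entry of U is 1, the superdiagonal entry of U at row q(p-1) is nonzero, so that row lies
-- in some block U_m, where diagonal = superdiagonal - 1.  The two exchange identities then make the
-- diagonal entry at row q-1 equal to 1, which happens only in the identity block; but q-1 < q(p-1).
module Submission where

open import Defs
open import Level using (Level)
open import Algebra.Bundles using (CommutativeRing)
open import Data.Nat using (ℕ; zero; suc; _≤_; _<_; s≤s; z≤n)
import Data.Nat as ℕ
open import Data.Nat.Primality using (Composite)
open import Data.Nat.Properties
  using (+-cancelˡ-≡; +-suc; +-monoʳ-≤; +-monoʳ-<; ≤-trans; <-≤-trans; <-irrefl; m≤m+n; m≤n+m;
         m<m+n; m≤m*n; ≤-refl; *-zeroʳ; *-suc; n≤1+n; suc-injective; module ≤-Reasoning)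
open import Data.Nat.Tactic.RingSolver using (solve-∀)
open import Data.Fin using (Fin; zero; suc; toℕ; splitAt; cast; combine; fromℕ)
open import Data.Fin.Properties
  using (splitAt⁻¹-↑ˡ; splitAt⁻¹-↑ʳ; toℕ-↑ˡ; toℕ-↑ʳ; toℕ<n; toℕ-cast; toℕ-combine; toℕ-fromℕ;
         remQuot-combine)
open import Data.Sum using (inj₁; inj₂)
open import Data.Product using (Σ; _×_; _,_; proj₁; proj₂)
open import Data.Vec using (Vec; []; _∷_; sum)
open import Data.Vec.Relation.Unary.All using (All; []; _∷_)
open import Data.Empty using (⊥-elim)
open import Relation.Binary.PropositionalEquality as ≡ using (_≡_; refl; cong; cong₂)
open import Relation.Nullary using (¬_)
open import Data.Maybe using (nothing)
open import Tactic.RingSolver.Core.AlmostCommutativeRing using (AlmostCommutativeRing; fromCommutativeRing)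
import Tactic.RingSolver as RingSolver

toℕ-splitAt-inj₁ : ∀ m {n} {x : Fin (m ℕ.+ n)} {i} → splitAt m x ≡ inj₁ i → toℕ x ≡ toℕ i
toℕ-splitAt-inj₁ m {n} {i = i} eq = ≡.trans (cong toℕ (≡.sym (splitAt⁻¹-↑ˡ eq))) (toℕ-↑ˡ i n)

toℕ-splitAt-inj₂ : ∀ m {n} {x : Fin (m ℕ.+ n)} {j} → splitAt m x ≡ inj₂ j → toℕ x ≡ m ℕ.+ toℕ j
toℕ-splitAt-inj₂ m {j = j} eq = ≡.trans (cong toℕ (≡.sym (splitAt⁻¹-↑ʳ eq))) (toℕ-↑ʳ m j)

splitAt-inj₁⇒< : ∀ m {n} {x : Fin (m ℕ.+ n)} {i} → splitAt m x ≡ inj₁ i → toℕ x < m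
splitAt-inj₁⇒< m {i = i} eq = ≡.subst (_< m) (≡.sym (toℕ-splitAt-inj₁ m eq)) (toℕ<n i)

splitAt-inj₁-suc : ∀ m {n} {x y : Fin (m ℕ.+ n)} {i j} → splitAt m x ≡ inj₁ i → splitAt m y ≡ inj₁ j →
                   toℕ y ≡ suc (toℕ x) → toℕ j ≡ suc (toℕ i)
splitAt-inj₁-suc m ex ey y≡x+1 =
  ≡.trans (≡.sym (toℕ-splitAt-inj₁ m ey)) (≡.trans y≡x+1 (cong suc (toℕ-splitAt-inj₁ m ex)))

splitAt-inj₂-suc : ∀ m {n} {x y : Fin (m ℕ.+ n)} {i j} → splitAt m x ≡ inj₂ i → splitAt m y ≡ inj₂ j →
                   toℕ y ≡ suc (toℕ x) → toℕ j ≡ suc (toℕ i)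
splitAt-inj₂-suc m {x = x} {y} {i} {j} ex ey y≡x+1 = +-cancelˡ-≡ m _ _ (begin
  m ℕ.+ toℕ j        ≡⟨ toℕ-splitAt-inj₂ m ey ⟨
  toℕ y              ≡⟨ y≡x+1 ⟩
  suc (toℕ x)        ≡⟨ cong suc (toℕ-splitAt-inj₂ m ex) ⟩
  suc (m ℕ.+ toℕ i)  ≡⟨ +-suc m (toℕ i) ⟨
  m ℕ.+ suc (toℕ i)  ∎)
  where open ≡.≡-Reasoning

-- The ring solver only recognises goals stated with the operations of an AlmostCommutativeRing.
module RingIdentities {c ℓ} (R : CommutativeRing c ℓ) where
  private
    ring′ : AlmostCommutativeRing c ℓ
    ring′ = fromCommutativeRing R (λ _ → nothing)
  open AlmostCommutativeRing ring′

  *-exchange : ∀ a b c d → (a * b) * (c * d) ≈ (a * d) * (c * b)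
  *-exchange = RingSolver.solve-∀ ring′

module CommutativeRingFacts {c ℓ} (R : CommutativeRing c ℓ) where
  open CommutativeRing R
  open import Algebra.Properties.Group +-group using (∙-cancelˡ; ⁻¹-injective)
  open import Algebra.Properties.Ring ring using (-‿distribʳ-*)
  open import Relation.Binary.Reasoning.Setoid setoid

  natElem-+ : ∀ m n → natElem R (m ℕ.+ n) ≈ natElem R m + natElem R n
  natElem-+ zero    n = sym (+-identityˡ _)
  natElem-+ (suc m) n = trans (+-congˡ (natElem-+ m n)) (sym (+-assoc _ _ _))

  natElem-* : ∀ m n → natElem R (m ℕ.* n) ≈ natElem R m * natElem R n
  natElem-* zero    n = sym (zeroˡ _)
  natElem-* (suc m) n = begin
    natElem R (n ℕ.+ m ℕ.* n)                    ≈⟨ natElem-+ n (m ℕ.* n) ⟩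
    natElem R n + natElem R (m ℕ.* n)            ≈⟨ +-cong (sym (*-identityˡ _)) (natElem-* m n) ⟩
    1# * natElem R n + natElem R m * natElem R n ≈⟨ distribʳ _ 1# (natElem R m) ⟨
    (1# + natElem R m) * natElem R n             ∎

  scale-shift⇒≈1 : ∀ {γ β t} → γ ≈ t * β → γ - 1# ≈ t * (β - 1#) → t ≈ 1#
  scale-shift⇒≈1 {γ} {β} {t} scale shift = sym (⁻¹-injective (∙-cancelˡ γ (- 1#) (- t) (begin
    γ - 1#            ≈⟨ shift ⟩
    t * (β - 1#)      ≈⟨ distribˡ t β (- 1#) ⟩
    t * β + t * - 1#  ≈⟨ +-congˡ (-‿distribʳ-* t 1#) ⟨
    t * β - t * 1#    ≈⟨ +-congˡ (-‿cong (*-identityʳ t)) ⟩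
    t * β - t         ≈⟨ +-congʳ scale ⟨
    γ - t             ∎)))

grid-last : ∀ p q → suc (suc q ℕ.* p ℕ.+ q) ≡ suc p ℕ.* suc q
grid-last = solve-∀

module Kronecker {c ℓ} (F : StarField c ℓ) where
  open Matrices F
  open StarField F using (*-cong; setoid)
  open RingIdentities (StarField.cring F)
  open import Relation.Binary.Reasoning.Setoid setoid

  ⊗-combine : ∀ {p q} (A : Mat p p) (B : Mat q q) i j i′ j′ →
              (A ⊗ B) (combine i j) (combine i′ j′) ≡ A i i′ * B j j′
  ⊗-combine A B i j i′ j′ =
    cong₂ _*_ (cong₂ A (cong proj₁ (remQuot-combine i j)) (cong proj₁ (remQuot-combine i′ j′)))
              (cong₂ B (cong proj₂ (remQuot-combine i j)) (cong proj₂ (remQuot-combine i′ j′)))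

  module Factorisation {N p q} {M : Mat N N} (eq : p ℕ.* q ≡ N) (u₁ : Mat p p) (u₂ : Mat q q)
                       (M≈u₁⊗u₂ : ∀ x y → M (cast eq x) (cast eq y) ≈ (u₁ ⊗ u₂) x y) where

    pos : Fin p → Fin q → Fin N
    pos i j = cast eq (combine i j)

    toℕ-pos : ∀ i j → toℕ (pos i j) ≡ q ℕ.* toℕ i ℕ.+ toℕ j
    toℕ-pos i j = ≡.trans (toℕ-cast eq (combine i j)) (toℕ-combine i j)

    entry : ∀ i j i′ j′ → M (pos i j) (pos i′ j′) ≈ u₁ i i′ * u₂ j j′
    entry i j i′ j′ = ≡.subst (M (pos i j) (pos i′ j′) ≈_) (⊗-combine u₁ u₂ i j i′ j′)
                        (M≈u₁⊗u₂ (combine i j) (combine i′ j′))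

    exchange : ∀ i j i′ j′ k l k′ l′ →
               M (pos i j) (pos i′ j′) * M (pos k l) (pos k′ l′) ≈
               M (pos i l) (pos i′ l′) * M (pos k j) (pos k′ j′)
    exchange i j i′ j′ k l k′ l′ = begin
      M (pos i j) (pos i′ j′) * M (pos k l) (pos k′ l′) ≈⟨ *-cong (entry i j i′ j′) (entry k l k′ l′) ⟩
      (u₁ i i′ * u₂ j j′) * (u₁ k k′ * u₂ l l′)         ≈⟨ *-exchange _ _ _ _ ⟩
      (u₁ i i′ * u₂ l l′) * (u₁ k k′ * u₂ j j′)         ≈⟨ *-cong (entry i l i′ l′) (entry k j k′ j′) ⟨
      M (pos i l) (pos i′ l′) * M (pos k j) (pos k′ j′) ∎

module DiffusionShapes {c ℓ} (F : StarField c ℓ) where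
  open Matrices F
  open StarField F using (*-congˡ; *-identityʳ; zeroʳ; setoid)
    renaming (sym to ≈-sym; trans to ≈-trans)
  open CommutativeRingFacts (StarField.cring F)
  open Kronecker F

  -- The features of U that the argument uses; D is the row where the identity part starts.
  record DiffusionShape {N} (D : ℕ) (M : Mat N N) : Set ℓ where
    field
      diag≈1⇒≥    : ∀ x → M x x ≈ 1# → D ≤ toℕ x
      superdiag≉0 : ∀ {x y} → toℕ y ≡ suc (toℕ x) → ¬ M x y ≈ 0# →
                    toℕ x < D × M x x ≈ M x y - 1#
      corner≉0    : ∀ {x y} → toℕ x ≡ 0 → toℕ y ≡ 1 → ¬ M x y ≈ 0#
      last≈1      : ∀ x → suc (toℕ x) ≡ N → M x x ≈ 1#

  vanishing-minors⇒<D≤ : ∀ {N D} {M : Mat N N} → DiffusionShape D M →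
    ∀ {x₀ x₁ a a₁ f e} → toℕ x₀ ≡ 0 → toℕ x₁ ≡ 1 → toℕ a₁ ≡ suc (toℕ a) → suc (toℕ e) ≡ N →
    M x₀ x₁ * M e e ≈ M f f * M a a₁ → M x₀ x₀ * M e e ≈ M f f * M a a →
    toℕ a < D × D ≤ toℕ f
  vanishing-minors⇒<D≤ {D = D} {M} shape {x₀} {x₁} {a} {a₁} {f} {e}
                       x₀≡0 x₁≡1 a₁≡a+1 e≡last minor₁ minor₀ =
    proj₁ a-superdiag , diag≈1⇒≥ f (scale-shift⇒≈1 γ≈tβ γ-1≈t[β-1])
    where
    open DiffusionShape shape
    open import Relation.Binary.Reasoning.Setoid setoid
    γ = M x₀ x₁
    β = M a a₁
    t = M f f

    *-Mee : ∀ z → z * M e e ≈ z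
    *-Mee z = ≈-trans (*-congˡ (last≈1 e e≡last)) (*-identityʳ z)

    γ≉0 : ¬ γ ≈ 0#
    γ≉0 = corner≉0 x₀≡0 x₁≡1

    γ≈tβ : γ ≈ t * β
    γ≈tβ = ≈-trans (≈-sym (*-Mee γ)) minor₁

    a-superdiag : toℕ a < D × M a a ≈ β - 1#
    a-superdiag = superdiag≉0 a₁≡a+1 λ β≈0 → γ≉0 (≈-trans γ≈tβ (≈-trans (*-congˡ β≈0) (zeroʳ t)))

    γ-1≈t[β-1] : γ - 1# ≈ t * (β - 1#)
    γ-1≈t[β-1] = begin
      γ - 1#             ≈⟨ proj₂ (superdiag≉0 (≡.trans x₁≡1 (cong suc (≡.sym x₀≡0))) γ≉0) ⟨
      M x₀ x₀            ≈⟨ *-Mee (M x₀ x₀) ⟨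
      M x₀ x₀ * M e e    ≈⟨ minor₀ ⟩
      t * M a a          ≈⟨ *-congˡ (proj₂ a-superdiag) ⟩
      t * (β - 1#)       ∎

  shape⇒¬kronecker : ∀ {N D} {M : Mat N N} → DiffusionShape D M →
                     ∀ {p q} → 2 ≤ p → 2 ≤ q → (eq : p ℕ.* q ≡ N) (u₁ : Mat p p) (u₂ : Mat q q) →
                     ¬ (∀ x y → M (cast eq x) (cast eq y) ≈ (u₁ ⊗ u₂) x y)
  shape⇒¬kronecker {N} {D} {M} shape {suc (suc p′)} {suc (suc q′)} (s≤s (s≤s z≤n)) (s≤s (s≤s z≤n))
                   eq u₁ u₂ M≈u₁⊗u₂ =
    <-irrefl refl (<-≤-trans (proj₁ a<D≤f) (≤-trans (proj₂ a<D≤f) f≤a))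
    where
    open Factorisation {M = M} eq u₁ u₂ M≈u₁⊗u₂
    open ≤-Reasoning
    q = suc (suc q′)
    bottom = fromℕ (suc p′)
    right  = fromℕ (suc q′)
    second : Fin q
    second = suc zero

    toℕ-pos-zero : ∀ j → toℕ (pos zero j) ≡ toℕ j
    toℕ-pos-zero j = ≡.trans (toℕ-pos zero j) (cong (ℕ._+ toℕ j) (*-zeroʳ q))

    toℕ-pos-bottom : ∀ j → toℕ (pos bottom j) ≡ q ℕ.* suc p′ ℕ.+ toℕ j
    toℕ-pos-bottom j = ≡.trans (toℕ-pos bottom j) (cong (λ i → q ℕ.* i ℕ.+ toℕ j) (toℕ-fromℕ (suc p′)))

    a₁≡a+1 : toℕ (pos bottom second) ≡ suc (toℕ (pos bottom zero))
    a₁≡a+1 = begin-equality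
      toℕ (pos bottom second)      ≡⟨ toℕ-pos-bottom second ⟩
      q ℕ.* suc p′ ℕ.+ 1           ≡⟨ +-suc _ 0 ⟩
      suc (q ℕ.* suc p′ ℕ.+ 0)     ≡⟨ cong suc (toℕ-pos-bottom zero) ⟨
      suc (toℕ (pos bottom zero))  ∎

    e≡last : suc (toℕ (pos bottom right)) ≡ N
    e≡last = begin-equality
      suc (toℕ (pos bottom right))         ≡⟨ cong suc (toℕ-pos-bottom right) ⟩
      suc (q ℕ.* suc p′ ℕ.+ toℕ right)     ≡⟨ cong (λ j → suc (q ℕ.* suc p′ ℕ.+ j)) (toℕ-fromℕ (suc q′)) ⟩
      suc (q ℕ.* suc p′ ℕ.+ suc q′)        ≡⟨ grid-last (suc p′) (suc q′) ⟩
      suc (suc p′) ℕ.* q                   ≡⟨ eq ⟩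
      N                                    ∎

    f≤a : toℕ (pos zero right) ≤ toℕ (pos bottom zero)
    f≤a = begin
      toℕ (pos zero right)   ≡⟨ toℕ-pos-zero right ⟩
      toℕ right              ≡⟨ toℕ-fromℕ (suc q′) ⟩
      suc q′                 ≤⟨ n≤1+n _ ⟩
      q                      ≤⟨ m≤m*n q (suc p′) ⟩
      q ℕ.* suc p′           ≤⟨ m≤m+n _ 0 ⟩
      q ℕ.* suc p′ ℕ.+ 0     ≡⟨ toℕ-pos-bottom zero ⟨
      toℕ (pos bottom zero)  ∎

    a<D≤f : toℕ (pos bottom zero) < D × D ≤ toℕ (pos zero right)
    a<D≤f = vanishing-minors⇒<D≤ shape (toℕ-pos-zero zero) (toℕ-pos-zero second) a₁≡a+1 e≡last
              (exchange zero zero zero second bottom right bottom right)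
              (exchange zero zero zero zero bottom right bottom right)

module GroverBlock {c ℓ} (F : StarField c ℓ) where
  open StarField F hiding (refl)
  open Matrices F using (δ; Ublock)
  open CommutativeRingFacts cring
  open import Algebra.Properties.Group +-group using (identityʳ-unique)
  open import Algebra.Properties.Ring ring using (-0#≈0#)
  open import Relation.Binary.Reasoning.Setoid setoid

  -- the coefficient 2/(m+1) of J in U_{m+1}
  weight : ℕ → Carrier
  weight m = 2 ×1 * _⁻¹ (suc m ×1) (char0 m)

  weight-*-size : ∀ m → weight m * suc m ×1 ≈ 2 ×1
  weight-*-size m = begin
    (2 ×1 * m⁻¹) * suc m ×1   ≈⟨ *-assoc _ _ _ ⟩
    2 ×1 * (m⁻¹ * suc m ×1)   ≈⟨ *-congˡ (*-comm _ _) ⟩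
    2 ×1 * (suc m ×1 * m⁻¹)   ≈⟨ *-congˡ (⁻¹-inv _ (char0 m)) ⟩
    2 ×1 * 1#                 ≈⟨ *-identityʳ _ ⟩
    2 ×1                      ∎
    where m⁻¹ = _⁻¹ (suc m ×1) (char0 m)

  weight≉0 : ∀ m → ¬ weight m ≈ 0#
  weight≉0 m w≈0 = char0 1 (begin
    2 ×1                 ≈⟨ weight-*-size m ⟨
    weight m * suc m ×1  ≈⟨ *-congʳ w≈0 ⟩
    0# * suc m ×1        ≈⟨ zeroˡ _ ⟩
    0#                   ∎)

  weight≉2 : ∀ m → ¬ weight (suc m) ≈ 2 ×1
  weight≉2 m w≈2 = char0 (m ℕ.+ (suc m ℕ.+ 0)) (identityʳ-unique (2 ×1) _ (begin
    2 ×1 + (2 ℕ.* suc m) ×1         ≈⟨ natElem-+ 2 (2 ℕ.* suc m) ⟨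
    (2 ℕ.+ 2 ℕ.* suc m) ×1          ≡⟨ cong _×1 (≡.sym (*-suc 2 (suc m))) ⟩
    (2 ℕ.* suc (suc m)) ×1          ≈⟨ natElem-* 2 (suc (suc m)) ⟩
    2 ×1 * suc (suc m) ×1           ≈⟨ *-congʳ w≈2 ⟨
    weight (suc m) * suc (suc m) ×1 ≈⟨ weight-*-size (suc m) ⟩
    2 ×1                            ∎))

  δ-diag : ∀ {n} (i : Fin n) → δ i i ≡ 1#
  δ-diag zero    = refl
  δ-diag (suc i) = δ-diag i

  δ-superdiag : ∀ {n} {i j : Fin n} → toℕ j ≡ suc (toℕ i) → δ i j ≡ 0#
  δ-superdiag {i = zero}  {suc j} _  = refl
  δ-superdiag {i = suc i} {suc j} eq = δ-superdiag (suc-injective eq)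

  Ublock-diag : ∀ {m} (i : Fin (suc m)) → Ublock (suc m) i i ≈ weight m - 1#
  Ublock-diag {m} i = +-cong (*-identityʳ (weight m)) (-‿cong (reflexive (δ-diag i)))

  Ublock-superdiag : ∀ {m} {i j : Fin (suc m)} → toℕ j ≡ suc (toℕ i) → Ublock (suc m) i j ≈ weight m
  Ublock-superdiag {m} {i} {j} eq = begin
    weight m * 1# - δ i j  ≈⟨ +-cong (*-identityʳ (weight m)) (-‿cong (reflexive (δ-superdiag eq))) ⟩
    weight m - 0#         ≈⟨ +-congˡ -0#≈0# ⟩
    weight m + 0#         ≈⟨ +-identityʳ (weight m) ⟩
    weight m              ∎

  Ublock-superdiag≉0 : ∀ {n} {i j : Fin n} → toℕ j ≡ suc (toℕ i) → ¬ Ublock n i j ≈ 0#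
  Ublock-superdiag≉0 {suc m} eq u≈0 = weight≉0 m (trans (sym (Ublock-superdiag eq)) u≈0)

  Ublock-diag≈superdiag-1 : ∀ {n} {i j : Fin n} → toℕ j ≡ suc (toℕ i) →
                            Ublock n i i ≈ Ublock n i j - 1#
  Ublock-diag≈superdiag-1 {suc m} {i} eq = trans (Ublock-diag i) (+-congʳ (sym (Ublock-superdiag eq)))

  Ublock-diag≉1 : ∀ {n} → 2 ≤ n → (i : Fin n) → ¬ Ublock n i i ≈ 1#
  Ublock-diag≉1 {suc (suc m)} (s≤s (s≤s z≤n)) i u≈1 = weight≉2 m (begin
    weight (suc m)               ≈⟨ +-identityʳ _ ⟨
    weight (suc m) + 0#          ≈⟨ +-congˡ (-‿inverseˡ 1#) ⟨
    weight (suc m) + (- 1# + 1#) ≈⟨ +-assoc _ _ _ ⟨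
    (weight (suc m) - 1#) + 1#   ≈⟨ +-congʳ (trans (sym (Ublock-diag i)) u≈1) ⟩
    1# + 1#                      ≈⟨ +-congˡ (+-identityʳ 1#) ⟨
    2 ×1                         ∎)

module GroverMatrix {c ℓ} (F : StarField c ℓ) where
  open Matrices F
  open StarField F using (reflexive) renaming (refl to ≈-refl)
  open GroverBlock F
  open DiffusionShapes F using (DiffusionShape)

  nl≤dim : ∀ {k} (ns : Vec ℕ k) nl → nl ≤ dim ns nl
  nl≤dim []       nl = ≤-refl
  nl≤dim (n ∷ ns) nl = ≤-trans (nl≤dim ns nl) (m≤n+m _ n)

  Umat-diag≈1⇒≥ : ∀ {k} {ns : Vec ℕ k} → All (2 ≤_) ns → ∀ {nl} (x : Fin (dim ns nl)) →
                  Umat ns nl x x ≈ 1# → sum ns ≤ toℕ x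
  Umat-diag≈1⇒≥ []           _ _ = z≤n
  Umat-diag≈1⇒≥ {ns = n ∷ ns} (n≥2 ∷ ns≥2) x x≈1 with splitAt n x in eq
  ... | inj₁ i = ⊥-elim (Ublock-diag≉1 n≥2 i x≈1)
  ... | inj₂ j = ≡.subst (n ℕ.+ sum ns ≤_) (≡.sym (toℕ-splitAt-inj₂ n eq))
                   (+-monoʳ-≤ n (Umat-diag≈1⇒≥ ns≥2 j x≈1))

  Umat-superdiag≉0 : ∀ {k} (ns : Vec ℕ k) {nl} {x y : Fin (dim ns nl)} → toℕ y ≡ suc (toℕ x) →
                     ¬ Umat ns nl x y ≈ 0# → toℕ x < sum ns × Umat ns nl x x ≈ Umat ns nl x y - 1#
  Umat-superdiag≉0 [] y≡x+1 xy≉0 = ⊥-elim (xy≉0 (reflexive (δ-superdiag y≡x+1)))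
  Umat-superdiag≉0 (n ∷ ns) {x = x} {y} y≡x+1 xy≉0 with splitAt n x in ex | splitAt n y in ey
  ... | inj₁ _ | inj₂ _ = ⊥-elim (xy≉0 ≈-refl)
  ... | inj₂ _ | inj₁ _ = ⊥-elim (xy≉0 ≈-refl)
  ... | inj₁ _ | inj₁ _ =
    ≤-trans (splitAt-inj₁⇒< n ex) (m≤m+n n (sum ns)) ,
    Ublock-diag≈superdiag-1 (splitAt-inj₁-suc n ex ey y≡x+1)
  ... | inj₂ _ | inj₂ _ with x<D , diag ← Umat-superdiag≉0 ns (splitAt-inj₂-suc n ex ey y≡x+1) xy≉0 =
    ≡.subst (_< n ℕ.+ sum ns) (≡.sym (toℕ-splitAt-inj₂ n ex)) (+-monoʳ-< n x<D) , diag

  Umat-corner≉0 : ∀ {k n} (ns : Vec ℕ k) → 2 ≤ n → ∀ {nl} {x y : Fin (dim (n ∷ ns) nl)} →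
                  toℕ x ≡ 0 → toℕ y ≡ 1 → ¬ Umat (n ∷ ns) nl x y ≈ 0#
  Umat-corner≉0 {n = n} ns (s≤s (s≤s z≤n)) {x = x} {y} x≡0 y≡1
    with splitAt n x in ex | splitAt n y in ey
  ... | inj₂ _ | _      with () ← ≡.trans (≡.sym x≡0) (toℕ-splitAt-inj₂ n ex)
  ... | inj₁ _ | inj₂ _ with () ← ≡.trans (≡.sym y≡1) (toℕ-splitAt-inj₂ n ey)
  ... | inj₁ _ | inj₁ _ =
    Ublock-superdiag≉0 (splitAt-inj₁-suc n ex ey (≡.trans y≡1 (cong suc (≡.sym x≡0))))

  Umat-last≈1 : ∀ {k} (ns : Vec ℕ k) {nl} → 1 ≤ nl → (x : Fin (dim ns nl)) →
                suc (toℕ x) ≡ dim ns nl → Umat ns nl x x ≈ 1#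
  Umat-last≈1 []       _     x _ = reflexive (δ-diag x)
  Umat-last≈1 (n ∷ ns) {nl} nl≥1 x x≡last with splitAt n x in eq
  ... | inj₁ _ = ⊥-elim (<-irrefl refl (<-≤-trans n<x+1 (splitAt-inj₁⇒< n eq)))
    where
    n<x+1 : n < suc (toℕ x)
    n<x+1 = ≡.subst (n <_) (≡.sym x≡last) (m<m+n n (≤-trans nl≥1 (nl≤dim ns nl)))
  ... | inj₂ j = Umat-last≈1 ns nl≥1 j
                   (+-cancelˡ-≡ n _ _ (≡.trans (+-suc n (toℕ j))
                                     (≡.trans (cong suc (≡.sym (toℕ-splitAt-inj₂ n eq))) x≡last)))

  Umat-shape : ∀ {k n} {ns : Vec ℕ k} → All (2 ≤_) (n ∷ ns) → ∀ {nl} → 1 ≤ nl →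
               DiffusionShape (sum (n ∷ ns)) (Umat (n ∷ ns) nl)
  Umat-shape {ns = ns} ns≥2@(n≥2 ∷ _) nl≥1 = record
    { diag≈1⇒≥    = Umat-diag≈1⇒≥ ns≥2
    ; superdiag≉0 = Umat-superdiag≉0 (_ ∷ ns)
    ; corner≉0    = Umat-corner≉0 ns n≥2
    ; last≈1      = Umat-last≈1 (_ ∷ ns) nl≥1
    }

theorem5 : {c ℓ : Level} (F : StarField c ℓ) →
    let open Matrices F in
    (k : ℕ) → 1 ≤ k → (ns : Vec ℕ k) → All (2 ≤_) ns → (nl : ℕ) → 1 ≤ nl →
    Composite (dim ns nl) →
    (p q : ℕ) → 2 ≤ p → 2 ≤ q → (eq : p ℕ.* q ≡ dim ns nl) →
    ¬ (Σ (Mat p p) λ u₁ → Σ (Mat q q) λ u₂ →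
    Unitary u₁ × Unitary u₂ ×
    (∀ x y → Umat ns nl (cast eq x) (cast eq y) ≈ (u₁ ⊗ u₂) x y))
theorem5 F _ _ (_ ∷ _) ns≥2 _ nl≥1 _ _ _ p≥2 q≥2 eq (u₁ , u₂ , _ , _ , U≈u₁⊗u₂) =
  DiffusionShapes.shape⇒¬kronecker F (GroverMatrix.Umat-shape F ns≥2 nl≥1) p≥2 q≥2 eq u₁ u₂ U≈u₁⊗u₂
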